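{- Let $\underline{d}=(d_1,\dots,d_n)$ be a non-increasing sequence of positive integers with maximal element $a=d_1$ and minimal element $b=d_n$, where $b<n$. Call an index $k\in\{1,\dots,n\}$ strong if $d_k\ge k$, and let $k_m$ be the largest strong index. For $j\ge 0$ let $n_j=\#\{i: d_i=j\}$, and for $1\le k\le n$ let $r_k=\sum_{i=1}^k\big(d_i+i\,n_{k-i}\big)$. Let $k$ be a strong index with $k>b$. Then \[ r_k\le k(n-1)+k_m(a+b+1)-k_m^2-bn, \] and equality is only possible when $k=k_m$ and $\underline{d}=(a^{k_m},b^{n-k_m})$ (i.e. $a$ repeated $k_m$ times followed by $b$ repeated $n-k_m$ times). -}

module Defs where

open import Data.Nat using (ℕ; zero; suc; _+_; _*_; _∸_; _≤_; _<_)
open import Data.Nat.Properties using (_≟_)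
open import Data.Fin using (Fin; fromℕ<)
open import Data.Nat.Properties using (_<?_)
open import Relation.Nullary using (yes; no; Dec)
open import Relation.Nullary.Decidable using (⌊_⌋)
open import Data.Bool using (if_then_else_)
open import Data.Product using (_×_)

-- 1-indexed access to a sequence d = (d₁,…,dₙ) given as d : Fin n → ℕ.
-- D d i = d_i for 1 ≤ i ≤ n, and 0 outside this range (never used there).
D : {n : ℕ} → (Fin n → ℕ) → ℕ → ℕ
D {n} d zero = 0
D {n} d (suc i) with i <? n
... | yes p = d (fromℕ< p)
... | no _ = 0

Σ₁ : ℕ → (ℕ → ℕ) → ℕ
Σ₁ zero f = 0
Σ₁ (suc k) f = Σ₁ k f + f (suc k)

NonIncreasing : {n : ℕ} → (Fin n → ℕ) → Set
NonIncreasing {n} d = ∀ i j → 1 ≤ i → i ≤ j → j ≤ n → D d j ≤ D d i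

Positive : {n : ℕ} → (Fin n → ℕ) → Set
Positive {n} d = ∀ i → 1 ≤ i → i ≤ n → 1 ≤ D d i

Strong : {n : ℕ} → (Fin n → ℕ) → ℕ → Set
Strong {n} d k = 1 ≤ k × k ≤ n × k ≤ D d k

LargestStrong : {n : ℕ} → (Fin n → ℕ) → ℕ → Set
LargestStrong d km = Strong d km × (∀ k → Strong d k → k ≤ km)

count : {n : ℕ} → (Fin n → ℕ) → ℕ → ℕ
count {n} d j = Σ₁ n (λ i → if ⌊ D d i ≟ j ⌋ then 1 else 0)

r : {n : ℕ} → (Fin n → ℕ) → ℕ → ℕ
r d k = Σ₁ k (λ i → D d i + i * count d (k ∸ i))

-- Exchanging the order of summation, Σ_{i ≤ k} i·n_{k−i} = Σ_t (k − d_t)⁺: index t contributes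
-- i = k − d_t exactly when d_t < k.  These deficits vanish for t ≤ k_m, since d_t ≥ d_{k_m} ≥ k_m ≥ k,
-- and are at most k − b for the other n − k_m indices, while Σ_{i ≤ k} d_i ≤ k a.  Hence
-- r_k ≤ k a + (n − k_m)(k − b), which is the claimed bound minus (k_m − k)(a − k_m + 1) ≥ 0;
-- equality forces k = k_m and makes every one of these estimates sharp.
module Submission where

open import Defs

-- ℕ arithmetic is scoped to this module: the statement of lemma4 uses ℤ's _+_ and _*_ unqualified.
module RBound where
  open import Data.Bool using (if_then_else_)
  open import Data.Fin using (Fin)
  open import Data.Nat
  open import Data.Nat.Properties
  open import Algebra.Properties.CommutativeSemigroup +-commutativeSemigroup using () renaming (interchange to +-interchange)
  open import Data.Product using (_×_; _,_)
  open import Data.Sum using (inj₁; inj₂)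
  open import Relation.Nullary using (yes; no; contradiction)
  open import Relation.Nullary.Decidable using (⌊_⌋)
  open import Relation.Binary.PropositionalEquality

  𝟙[_≡_] : ℕ → ℕ → ℕ
  𝟙[ v ≡ j ] = if ⌊ v ≟ j ⌋ then 1 else 0

  𝟙-yes : ∀ {v j} → v ≡ j → 𝟙[ v ≡ j ] ≡ 1
  𝟙-yes {v} {j} v≡j with v ≟ j
  ... | yes _  = refl
  ... | no v≢j = contradiction v≡j v≢j

  𝟙-no : ∀ {v j} → v ≢ j → 𝟙[ v ≡ j ] ≡ 0
  𝟙-no {v} {j} v≢j with v ≟ j
  ... | yes v≡j = contradiction v≡j v≢j
  ... | no _    = refl

  +-mono-≤-equality : ∀ {x x′ y y′} → x ≤ x′ → y ≤ y′ → x + y ≡ x′ + y′ → x ≡ x′ × y ≡ y′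
  +-mono-≤-equality {x} {x′} {y} {y′} x≤x′ y≤y′ eq = x≡x′ , +-cancelˡ-≡ x y y′ (trans eq (cong (_+ y′) (sym x≡x′)))
    where
    x≡x′ : x ≡ x′
    x≡x′ = ≤-antisym x≤x′ (+-cancelʳ-≤ y′ x′ x (≤-trans (≤-reflexive (sym eq)) (+-monoʳ-≤ x y≤y′)))

  ∀≤-pred : ∀ {k} {P : ℕ → Set} → (∀ i → 1 ≤ i → i ≤ suc k → P i) → ∀ i → 1 ≤ i → i ≤ k → P i
  ∀≤-pred h i 1≤i i≤k = h i 1≤i (m≤n⇒m≤1+n i≤k)

  Σ₁-cong : ∀ k {f g : ℕ → ℕ} → (∀ i → 1 ≤ i → i ≤ k → f i ≡ g i) → Σ₁ k f ≡ Σ₁ k g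
  Σ₁-cong zero    f≡g = refl
  Σ₁-cong (suc k) f≡g = cong₂ _+_ (Σ₁-cong k (∀≤-pred f≡g)) (f≡g (suc k) z<s ≤-refl)

  Σ₁-mono-≤ : ∀ k {f g : ℕ → ℕ} → (∀ i → 1 ≤ i → i ≤ k → f i ≤ g i) → Σ₁ k f ≤ Σ₁ k g
  Σ₁-mono-≤ zero    f≤g = z≤n
  Σ₁-mono-≤ (suc k) f≤g = +-mono-≤ (Σ₁-mono-≤ k (∀≤-pred f≤g)) (f≤g (suc k) z<s ≤-refl)

  Σ₁-mono-≤-equality : ∀ k {f g : ℕ → ℕ} → (∀ i → 1 ≤ i → i ≤ k → f i ≤ g i) →
                       Σ₁ k f ≡ Σ₁ k g → ∀ i → 1 ≤ i → i ≤ k → f i ≡ g i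
  Σ₁-mono-≤-equality zero    _   _  _ (s≤s _) ()
  Σ₁-mono-≤-equality (suc k) f≤g eq i 1≤i i≤1+k with +-mono-≤-equality (Σ₁-mono-≤ k (∀≤-pred f≤g)) (f≤g (suc k) z<s ≤-refl) eq
  ... | Σf≡Σg , fk≡gk with m≤n⇒m<n∨m≡n i≤1+k
  ...   | inj₂ refl      = fk≡gk
  ...   | inj₁ (s≤s i≤k) = Σ₁-mono-≤-equality k (∀≤-pred f≤g) Σf≡Σg i 1≤i i≤k

  Σ₁-const : ∀ k c → Σ₁ k (λ _ → c) ≡ k * c
  Σ₁-const zero    c = refl
  Σ₁-const (suc k) c = trans (cong (_+ c) (Σ₁-const k c)) (+-comm (k * c) c)

  Σ₁-zero : ∀ k {f : ℕ → ℕ} → (∀ i → 1 ≤ i → i ≤ k → f i ≡ 0) → Σ₁ k f ≡ 0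
  Σ₁-zero k f≡0 = trans (Σ₁-cong k f≡0) (trans (Σ₁-const k 0) (*-zeroʳ k))

  Σ₁-single : ∀ k {f : ℕ → ℕ} c → 1 ≤ c → c ≤ k → (∀ i → 1 ≤ i → i ≤ k → i ≢ c → f i ≡ 0) → Σ₁ k f ≡ f c
  Σ₁-single zero        _ (s≤s _) () _
  Σ₁-single (suc k) {f} c 1≤c c≤1+k f≡0 with m≤n⇒m<n∨m≡n c≤1+k
  ... | inj₂ refl    = cong (_+ f c) (Σ₁-zero k (λ i 1≤i i≤k → f≡0 i 1≤i (m≤n⇒m≤1+n i≤k) (<⇒≢ (s≤s i≤k))))
  ... | inj₁ (s≤s c≤k) = begin
    Σ₁ k f + f (suc k) ≡⟨ cong₂ _+_ (Σ₁-single k c 1≤c c≤k (∀≤-pred f≡0))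
                                    (f≡0 (suc k) z<s ≤-refl (>⇒≢ (s≤s c≤k))) ⟩
    f c + 0            ≡⟨ +-identityʳ (f c) ⟩
    f c                ∎
    where open ≡-Reasoning

  Σ₁-+ : ∀ k (f g : ℕ → ℕ) → Σ₁ k (λ i → f i + g i) ≡ Σ₁ k f + Σ₁ k g
  Σ₁-+ zero    f g = refl
  Σ₁-+ (suc k) f g = trans (cong (_+ (f (suc k) + g (suc k))) (Σ₁-+ k f g))
                           (+-interchange (Σ₁ k f) (Σ₁ k g) (f (suc k)) (g (suc k)))

  Σ₁-*ˡ : ∀ k c (f : ℕ → ℕ) → Σ₁ k (λ i → c * f i) ≡ c * Σ₁ k f
  Σ₁-*ˡ zero    c f = sym (*-zeroʳ c)
  Σ₁-*ˡ (suc k) c f = trans (cong (_+ c * f (suc k)) (Σ₁-*ˡ k c f)) (sym (*-distribˡ-+ c (Σ₁ k f) (f (suc k))))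

  Σ₁-comm : ∀ k m (F : ℕ → ℕ → ℕ) → Σ₁ k (λ i → Σ₁ m (F i)) ≡ Σ₁ m (λ t → Σ₁ k (λ i → F i t))
  Σ₁-comm zero    m F = sym (Σ₁-zero m (λ _ _ _ → refl))
  Σ₁-comm (suc k) m F = trans (cong (_+ Σ₁ m (F (suc k))) (Σ₁-comm k m F))
                              (sym (Σ₁-+ m (λ t → Σ₁ k (λ i → F i t)) (F (suc k))))

  Σ₁-split : ∀ m h (f : ℕ → ℕ) → Σ₁ (m + h) f ≡ Σ₁ m f + Σ₁ h (λ j → f (m + j))
  Σ₁-split m zero    f = trans (cong (λ x → Σ₁ x f) (+-identityʳ m)) (sym (+-identityʳ (Σ₁ m f)))
  Σ₁-split m (suc h) f = begin
    Σ₁ (m + suc h) f                                          ≡⟨ cong (λ x → Σ₁ x f) (+-suc m h) ⟩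
    Σ₁ (m + h) f + f (suc (m + h))                            ≡⟨ cong (_+ f (suc (m + h))) (Σ₁-split m h f) ⟩
    Σ₁ m f + Σ₁ h (λ j → f (m + j)) + f (suc (m + h))         ≡⟨ +-assoc (Σ₁ m f) _ _ ⟩
    Σ₁ m f + (Σ₁ h (λ j → f (m + j)) + f (suc (m + h)))       ≡⟨ cong (λ x → Σ₁ m f + (Σ₁ h (λ j → f (m + j)) + f x)) (sym (+-suc m h)) ⟩
    Σ₁ m f + Σ₁ (suc h) (λ j → f (m + j))                     ∎
    where open ≡-Reasoning

  Σ₁-weighted-𝟙 : ∀ k v → Σ₁ k (λ i → i * 𝟙[ v ≡ k ∸ i ]) ≡ k ∸ v
  Σ₁-weighted-𝟙 k v with v <? k
  ... | yes v<k = trans (Σ₁-single k (k ∸ v) (m<n⇒0<n∸m v<k) (m∸n≤m k v) miss) hit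
    where
    miss : ∀ i → 1 ≤ i → i ≤ k → i ≢ k ∸ v → i * 𝟙[ v ≡ k ∸ i ] ≡ 0
    miss i _ i≤k i≢k∸v = trans (cong (i *_) (𝟙-no (λ v≡k∸i → i≢k∸v (trans (sym (m∸[m∸n]≡n i≤k)) (cong (k ∸_) (sym v≡k∸i))))))
                               (*-zeroʳ i)
    hit : (k ∸ v) * 𝟙[ v ≡ k ∸ (k ∸ v) ] ≡ k ∸ v
    hit = trans (cong ((k ∸ v) *_) (𝟙-yes (sym (m∸[m∸n]≡n (<⇒≤ v<k))))) (*-identityʳ (k ∸ v))
  ... | no v≮k = trans (Σ₁-zero k miss) (sym (m≤n⇒m∸n≡0 (≮⇒≥ v≮k)))
    where
    miss : ∀ i → 1 ≤ i → i ≤ k → i * 𝟙[ v ≡ k ∸ i ] ≡ 0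
    miss i 1≤i i≤k = trans (cong (i *_) (𝟙-no (λ v≡k∸i → v≮k (subst (_< k) (sym v≡k∸i) (∸-monoʳ-< 1≤i i≤k)))))
                           (*-zeroʳ i)

  Σ₁-weighted-count : ∀ k m (f : ℕ → ℕ) →
                      Σ₁ k (λ i → i * Σ₁ m (λ t → 𝟙[ f t ≡ k ∸ i ])) ≡ Σ₁ m (λ t → k ∸ f t)
  Σ₁-weighted-count k m f = begin
    Σ₁ k (λ i → i * Σ₁ m (λ t → 𝟙[ f t ≡ k ∸ i ]))   ≡⟨ Σ₁-cong k (λ i _ _ → sym (Σ₁-*ˡ m i (λ t → 𝟙[ f t ≡ k ∸ i ]))) ⟩
    Σ₁ k (λ i → Σ₁ m (λ t → i * 𝟙[ f t ≡ k ∸ i ]))   ≡⟨ Σ₁-comm k m (λ i t → i * 𝟙[ f t ≡ k ∸ i ]) ⟩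
    Σ₁ m (λ t → Σ₁ k (λ i → i * 𝟙[ f t ≡ k ∸ i ]))   ≡⟨ Σ₁-cong m (λ t _ _ → Σ₁-weighted-𝟙 k (f t)) ⟩
    Σ₁ m (λ t → k ∸ f t)                             ∎
    where open ≡-Reasoning

  r≡Σ₁+deficits : ∀ {n} (d : Fin n → ℕ) k → r d k ≡ Σ₁ k (D d) + Σ₁ n (λ t → k ∸ D d t)
  r≡Σ₁+deficits {n} d k = trans (Σ₁-+ k (D d) (λ i → i * count d (k ∸ i)))
                                (cong (_+_ (Σ₁ k (D d))) (Σ₁-weighted-count k n (D d)))

  module _ {n : ℕ} {d : Fin n → ℕ} (d-nonincreasing : NonIncreasing d) where

    ≤-head : ∀ {i} → 1 ≤ i → i ≤ n → D d i ≤ D d 1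
    ≤-head 1≤i i≤n = d-nonincreasing 1 _ ≤-refl 1≤i i≤n

    last-≤ : ∀ {i} → 1 ≤ i → i ≤ n → D d n ≤ D d i
    last-≤ 1≤i i≤n = d-nonincreasing _ n 1≤i i≤n ≤-refl

    Σ₁-≤-head : ∀ {k} → k ≤ n → Σ₁ k (D d) ≤ k * D d 1
    Σ₁-≤-head {k} k≤n = ≤-trans (Σ₁-mono-≤ k (λ i 1≤i i≤k → ≤-head 1≤i (≤-trans i≤k k≤n))) (≤-reflexive (Σ₁-const k (D d 1)))

    Σ₁-≡-head : ∀ {k} → k ≤ n → Σ₁ k (D d) ≡ k * D d 1 → ∀ i → 1 ≤ i → i ≤ k → D d i ≡ D d 1
    Σ₁-≡-head {k} k≤n eq = Σ₁-mono-≤-equality k (λ i 1≤i i≤k → ≤-head 1≤i (≤-trans i≤k k≤n))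
                                                 (trans eq (sym (Σ₁-const k (D d 1))))

    module _ {m : ℕ} (m≤n : m ≤ n) (k : ℕ) where

      tail-deficits : ℕ
      tail-deficits = Σ₁ (n ∸ m) (λ j → k ∸ D d (m + j))

      private
        tail-deficit-≤ : ∀ j → 1 ≤ j → j ≤ n ∸ m → k ∸ D d (m + j) ≤ k ∸ D d n
        tail-deficit-≤ j 1≤j j≤n∸m = ∸-monoʳ-≤ k (last-≤ (≤-trans 1≤j (m≤n+m j m))
                                                         (≤-trans (+-monoʳ-≤ m j≤n∸m) (≤-reflexive (m+[n∸m]≡n m≤n))))

      tail-deficits-≤ : tail-deficits ≤ (n ∸ m) * (k ∸ D d n)
      tail-deficits-≤ = ≤-trans (Σ₁-mono-≤ (n ∸ m) tail-deficit-≤) (≤-reflexive (Σ₁-const (n ∸ m) (k ∸ D d n)))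

      tail-deficits-≡ : D d n < k → tail-deficits ≡ (n ∸ m) * (k ∸ D d n) → ∀ i → m < i → i ≤ n → D d i ≡ D d n
      tail-deficits-≡ dₙ<k eq i m<i i≤n = ∸-cancelˡ-≡ dᵢ≤k (<⇒≤ dₙ<k) deficitᵢ
        where
        deficitᵢ : k ∸ D d i ≡ k ∸ D d n
        deficitᵢ = subst (λ t → k ∸ D d t ≡ k ∸ D d n) (m+[n∸m]≡n (<⇒≤ m<i))
          (Σ₁-mono-≤-equality (n ∸ m) tail-deficit-≤ (trans eq (sym (Σ₁-const (n ∸ m) (k ∸ D d n))))
                              (i ∸ m) (m<n⇒0<n∸m m<i) (∸-monoˡ-≤ m i≤n))
        dᵢ≤k : D d i ≤ k
        dᵢ≤k = <⇒≤ (m∸n≢0⇒n<m (λ k∸dᵢ≡0 → <⇒≢ (m<n⇒0<n∸m dₙ<k) (sym (trans (sym deficitᵢ) k∸dᵢ≡0))))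

    deficits≡tail-deficits : ∀ {m k} → (m≤n : m ≤ n) → k ≤ D d m →
                             Σ₁ n (λ t → k ∸ D d t) ≡ tail-deficits m≤n k
    deficits≡tail-deficits {m} {k} m≤n k≤dₘ = begin
      Σ₁ n deficit                          ≡⟨ cong (λ x → Σ₁ x deficit) (sym (m+[n∸m]≡n m≤n)) ⟩
      Σ₁ (m + (n ∸ m)) deficit              ≡⟨ Σ₁-split m (n ∸ m) deficit ⟩
      Σ₁ m deficit + tail-deficits m≤n k    ≡⟨ cong (_+ tail-deficits m≤n k) (Σ₁-zero m (λ t 1≤t t≤m →
                                                 m≤n⇒m∸n≡0 (≤-trans k≤dₘ (d-nonincreasing t m 1≤t t≤m m≤n)))) ⟩
      tail-deficits m≤n k                   ∎
      where
      open ≡-Reasoning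
      deficit : ℕ → ℕ
      deficit t = k ∸ D d t

    r-bound : ∀ {km k} → LargestStrong d km → Strong d k → D d n < k →
              r d k ≤ k * D d 1 + (n ∸ km) * (k ∸ D d n)
              × (r d k ≡ k * D d 1 + (n ∸ km) * (k ∸ D d n) + (km ∸ k) * suc (D d 1 ∸ km) →
                 k ≡ km × (∀ i → 1 ≤ i → i ≤ km → D d i ≡ D d 1) × (∀ i → km < i → i ≤ n → D d i ≡ D d n))
    r-bound {km} {k} ((1≤km , km≤n , km≤dₖₘ) , largest) k-strong@(_ , k≤n , _) dₙ<k = r≤ , equality
      where
      k≤km : k ≤ km
      k≤km = largest k k-strong
      r≡ : r d k ≡ Σ₁ k (D d) + tail-deficits km≤n k
      r≡ = trans (r≡Σ₁+deficits d k) (cong (_+_ (Σ₁ k (D d))) (deficits≡tail-deficits km≤n (≤-trans k≤km km≤dₖₘ)))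
      head≤ : Σ₁ k (D d) ≤ k * D d 1
      head≤ = Σ₁-≤-head k≤n
      tail≤ : tail-deficits km≤n k ≤ (n ∸ km) * (k ∸ D d n)
      tail≤ = tail-deficits-≤ km≤n k
      r≤ : r d k ≤ k * D d 1 + (n ∸ km) * (k ∸ D d n)
      r≤ = ≤-trans (≤-reflexive r≡) (+-mono-≤ head≤ tail≤)
      equality : r d k ≡ k * D d 1 + (n ∸ km) * (k ∸ D d n) + (km ∸ k) * suc (D d 1 ∸ km) →
                 k ≡ km × (∀ i → 1 ≤ i → i ≤ km → D d i ≡ D d 1) × (∀ i → km < i → i ≤ n → D d i ≡ D d n)
      equality eq with +-mono-≤-equality r≤ z≤n (trans (+-identityʳ (r d k)) eq)
      ... | r≡bound , 0≡slack with +-mono-≤-equality head≤ tail≤ (trans (sym r≡) r≡bound)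
      ...   | head≡kd₁ , tail≡ =
        k≡km , (λ i 1≤i i≤km → Σ₁-≡-head k≤n head≡kd₁ i 1≤i (≤-trans i≤km (≤-reflexive (sym k≡km))))
             , tail-deficits-≡ km≤n k dₙ<k tail≡
        where
        k≡km : k ≡ km
        k≡km = ≤-antisym k≤km (m∸n≡0⇒m≤n (m*n≡0⇒m≡0 (km ∸ k) (suc (D d 1 ∸ km)) (sym 0≡slack)))

open import Data.Fin using (Fin)
open import Data.Nat using (ℕ; _≤_; _<_)
import Data.Nat as ℕ
import Data.Nat.Properties as ℕ
open import Data.Integer using (ℤ; +_; _+_; _-_; _*_; +≤+) renaming (_≤_ to _≤ℤ_)
open import Data.Integer.Properties using (+-injective; pos-+; pos-*; ⊖-≥; m-n≡m⊖n)
open import Data.Integer.Tactic.RingSolver using (solve-∀)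
open import Data.Product using (_×_; _,_)
open import Relation.Binary.PropositionalEquality using (_≡_; refl; sym; trans; subst; cong; cong₂; module ≡-Reasoning)
open RBound using (≤-head; r-bound)

pos-∸ : ∀ {m n} → n ℕ.≤ m → + (m ℕ.∸ n) ≡ + m - + n
pos-∸ {m} {n} n≤m = trans (sym (⊖-≥ n≤m)) (sym (m-n≡m⊖n m n))

bound≡ : ∀ {a b k km n} → b ≤ k → k ≤ km → km ≤ a → km ≤ n →
         (+ k) * (+ n - + 1) + (+ km) * (+ a + + b + + 1) - (+ km) * (+ km) - (+ b) * (+ n)
         ≡ + (k ℕ.* a ℕ.+ (n ℕ.∸ km) ℕ.* (k ℕ.∸ b) ℕ.+ (km ℕ.∸ k) ℕ.* ℕ.suc (a ℕ.∸ km))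
bound≡ {a} {b} {k} {km} {n} b≤k k≤km km≤a km≤n = sym (begin
  + (k ℕ.* a ℕ.+ (n ℕ.∸ km) ℕ.* (k ℕ.∸ b) ℕ.+ (km ℕ.∸ k) ℕ.* ℕ.suc (a ℕ.∸ km))
    ≡⟨ pos-+ (k ℕ.* a ℕ.+ (n ℕ.∸ km) ℕ.* (k ℕ.∸ b)) _ ⟩
  + (k ℕ.* a ℕ.+ (n ℕ.∸ km) ℕ.* (k ℕ.∸ b)) + + ((km ℕ.∸ k) ℕ.* ℕ.suc (a ℕ.∸ km))
    ≡⟨ cong₂ _+_ (trans (pos-+ (k ℕ.* a) _) (cong₂ _+_ (pos-* k a)
                   (trans (pos-* (n ℕ.∸ km) _) (cong₂ _*_ (pos-∸ km≤n) (pos-∸ b≤k)))))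
                 (trans (pos-* (km ℕ.∸ k) _) (cong₂ _*_ (pos-∸ k≤km) (trans (pos-+ 1 (a ℕ.∸ km)) (cong (_+_ (+ 1)) (pos-∸ km≤a))))) ⟩
  + k * + a + (+ n - + km) * (+ k - + b) + (+ km - + k) * (+ 1 + (+ a - + km))
    ≡⟨ polynomial (+ a) (+ b) (+ k) (+ km) (+ n) ⟩
  (+ k) * (+ n - + 1) + (+ km) * (+ a + + b + + 1) - (+ km) * (+ km) - (+ b) * (+ n) ∎)
  where
  open ≡-Reasoning
  polynomial : ∀ (A B K KM N : ℤ) →
    K * A + (N - KM) * (K - B) + (KM - K) * (+ 1 + (A - KM)) ≡ K * (N - + 1) + KM * (A + B + + 1) - KM * KM - B * N
  polynomial = solve-∀

lemma4 : (n : ℕ) (d : Fin n → ℕ) (a b km k : ℕ) →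
    1 ≤ n → Positive d → NonIncreasing d →
    a ≡ D d 1 → b ≡ D d n → b < n →
    LargestStrong d km →
    Strong d k → b < k →
    ((+ r d k) ≤ℤ (+ k) * (+ n - + 1) + (+ km) * (+ a + + b + + 1) - (+ km) * (+ km) - (+ b) * (+ n))
    × ((+ r d k) ≡ (+ k) * (+ n - + 1) + (+ km) * (+ a + + b + + 1) - (+ km) * (+ km) - (+ b) * (+ n) →
       k ≡ km
       × (∀ i → 1 ≤ i → i ≤ km → D d i ≡ a)
       × (∀ i → km < i → i ≤ n → D d i ≡ b))
lemma4 n d _ _ km k _ _ noninc refl refl _ largest@((1≤km , km≤n , km≤dₖₘ) , maximal) k-strong b<k
  with r-bound noninc largest k-strong b<k
... | r≤bound , sharp =
  subst (+ r d k ≤ℤ_) (sym bound≡rhs) (+≤+ (ℕ.≤-trans r≤bound (ℕ.m≤m+n _ _))) ,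
  λ eq → sharp (+-injective (trans eq bound≡rhs))
  where
  a b : ℕ
  a = D d 1
  b = D d n
  bound≡rhs : (+ k) * (+ n - + 1) + (+ km) * (+ a + + b + + 1) - (+ km) * (+ km) - (+ b) * (+ n)
              ≡ + (k ℕ.* a ℕ.+ (n ℕ.∸ km) ℕ.* (k ℕ.∸ b) ℕ.+ (km ℕ.∸ k) ℕ.* ℕ.suc (a ℕ.∸ km))
  bound≡rhs = bound≡ (ℕ.<⇒≤ b<k) (maximal k k-strong) (ℕ.≤-trans km≤dₖₘ (≤-head noninc 1≤km km≤n)) km≤n
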